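{- Let $p,q,r\geq 3$ be pairwise distinct primes, $\alpha,\beta,\gamma\geq 1$ integers, and $\Gamma=\mathrm{Cay}(\mathbb{Z}_{p}\times\mathbb{Z}_{p^{\alpha}q^{\beta}r^{\gamma}},\Phi)$ with $\Phi=\varphi_p\times\varphi_{p^{\alpha}q^{\beta}r^{\gamma}}$. Then $\mathrm{diam}(\Gamma)=2$.
   Context: For $n\geq 1$, $\mathbb{Z}_n=\{0,\dots,n-1\}$ is the integers mod $n$ and $\varphi_n$ is the set of elements of $\mathbb{Z}_n$ coprime to $n$ ($\varphi_p=\mathbb{Z}_p\setminus\{0\}$). $\mathrm{Cay}(\mathbb{Z}_p\times\mathbb{Z}_m,\varphi_p\times\varphi_m)$ is the graph on $\mathbb{Z}_p\times\mathbb{Z}_m$ where $(u,v)\sim(u',v')$ iff $u-u'\in\varphi_p$ and $v-v'\in\varphi_m$. -}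

module Defs where

open import Level using (0ℓ)
open import Data.Nat using (ℕ; zero; suc; _+_; _∸_; _≤_; _<_; _≤ᵇ_)
open import Data.Nat.Coprimality using (Coprime)
open import Data.Fin using (Fin; toℕ)
open import Data.Product using (_×_; _,_; Σ; ∃-syntax)
open import Data.Bool using (if_then_else_)
open import Relation.Nullary using (¬_)

subMod : (n : ℕ) → Fin n → Fin n → ℕ
subMod n a b = if toℕ b ≤ᵇ toℕ a then toℕ a ∸ toℕ b else (n + toℕ a) ∸ toℕ b

InPhi : ℕ → ℕ → Set
InPhi n x = Coprime x n

CayV : ℕ → ℕ → Set
CayV p m = Fin p × Fin m

CayAdj : (p m : ℕ) → CayV p m → CayV p m → Set
CayAdj p m (u , v) (u' , v') = InPhi p (subMod p u u') × InPhi m (subMod m v v')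

data Walk {V : Set} (E : V → V → Set) : ℕ → V → V → Set where
  here : ∀ {x} → Walk E 0 x x
  step : ∀ {k x y z} → E x y → Walk E k y z → Walk E (suc k) x z

DistLe : {V : Set} → (V → V → Set) → V → V → ℕ → Set
DistLe E x y d = ∃[ k ] (k ≤ d × Walk E k x y)

HasDiameter : {V : Set} → (V → V → Set) → ℕ → Set
HasDiameter {V} E d =
  ((x y : V) → DistLe E x y d) ×
  (∃[ x ] ∃[ y ] (∀ k → k < d → ¬ Walk E k x y))

module Submission where

-- For odd n, any two vertices v, v' of Cay(ℤ_n, φ_n) have a common neighbour, so the product
-- graph has diameter at most 2. With d = v − v', let P be the product over the prime factors ℓ
-- of n of 1 if ℓ ∣ d and of ℓ otherwise, and take w = v' + 2d + P. Modulo each such ℓ the two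
-- steps w − v' = 2d + P and v − w = −(d + P) are ≡ P, −P when ℓ ∣ d and ≡ 2d, −d when ℓ ∤ d,
-- hence nonzero because ℓ is odd. Conversely no vertex is adjacent to itself, as 0 ∉ φ_n.

open import Defs
open import Data.Fin.Base using (Fin; zero; suc; toℕ; fromℕ<)
open import Data.Fin.Properties using (toℕ<n; toℕ-fromℕ<)
open import Data.Bool.Base using (true; false; T)
open import Data.Unit.Base using (tt)
open import Data.Product.Base as Product using (_×_; _,_; ∃-syntax; proj₁; proj₂)
open import Data.Sum.Base using (_⊎_; inj₁; inj₂)
open import Data.List.Base using (List; []; _∷_; map)
open import Data.List.Membership.Propositional using (_∈_)
open import Data.List.Relation.Unary.All using (All; []; _∷_)
open import Data.List.Relation.Unary.Any using (here; there)
open import Data.Nat.ListAction using (product)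
open import Data.Nat.Primality using (Prime; euclidsLemma; prime⇒irreducible; prime[2]; ¬prime[1])
open import Data.Nat.Primality.Factorisation
  using (PrimeFactorisation; factorise; factorisationHasAllPrimeFactors)
open import Function.Base using (_∘_)
open import Relation.Nullary using (¬_; Dec; yes; no; contradiction)
open import Relation.Nullary.Decidable using (map′)
open import Relation.Binary.PropositionalEquality
  using (_≡_; _≢_; refl; sym; cong; subst; module ≡-Reasoning)

open PrimeFactorisation

prime≢1 : ∀ {ℓ} → Prime ℓ → ℓ ≢ 1
prime≢1 pℓ refl = ¬prime[1] pℓ

module Detour where
  open import Data.Integer.Base as ℤ using (ℤ; +_; _⊖_; _+_; _-_; -_; _*_; _%ℕ_; _/ℕ_)
  open import Data.Integer.Properties
    using (⊖-≥; [+m]-[+n]≡m⊖n; +-assoc; pos-+; neg-involutive; +-inverseʳ; abs-*)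
  open import Data.Integer.DivMod using (n%ℕd<d; a≡a%ℕn+[a/ℕn]*n)
  open import Data.Integer.Divisibility.Signed
    using ( _∣_; divides; ∣ᵤ⇒∣; ∣⇒∣ᵤ; ∣-refl; ∣-trans; ∣m∣n⇒∣m+n; ∣m∣n⇒∣m-n
          ; ∣m+n∣m⇒∣n; ∣m+n∣n⇒∣m; ∣m⇒∣-m; ∣n⇒∣m*n)
  open import Data.Integer.Tactic.RingSolver using (solve-∀)
  import Data.Nat.Base as ℕ
  import Data.Nat.Properties as ℕ
  import Data.Nat.Divisibility as ℕ
  open ≡-Reasoning

  ⟦_⟧ : ∀ {n} → Fin n → ℤ
  ⟦ a ⟧ = + toℕ a

  subMod-cases : ∀ n (a b : Fin n) →
    + subMod n a b ≡ ⟦ a ⟧ - ⟦ b ⟧ ⊎ + subMod n a b ≡ + n + (⟦ a ⟧ - ⟦ b ⟧)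
  subMod-cases n a b with toℕ b ℕ.≤ᵇ toℕ a in b≤ᵇa
  ... | true = inj₁ (begin
    + (toℕ a ℕ.∸ toℕ b)  ≡⟨ ⊖-≥ b≤a ⟨
    toℕ a ⊖ toℕ b        ≡⟨ [+m]-[+n]≡m⊖n (toℕ a) (toℕ b) ⟨
    ⟦ a ⟧ - ⟦ b ⟧        ∎)
    where b≤a = ℕ.≤ᵇ⇒≤ (toℕ b) (toℕ a) (subst T (sym b≤ᵇa) tt)
  ... | false = inj₂ (begin
    + (n ℕ.+ toℕ a ℕ.∸ toℕ b)  ≡⟨ ⊖-≥ b≤n+a ⟨
    (n ℕ.+ toℕ a) ⊖ toℕ b      ≡⟨ [+m]-[+n]≡m⊖n (n ℕ.+ toℕ a) (toℕ b) ⟨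
    + (n ℕ.+ toℕ a) - ⟦ b ⟧    ≡⟨ cong (_- ⟦ b ⟧) (pos-+ n (toℕ a)) ⟩
    + n + ⟦ a ⟧ - ⟦ b ⟧        ≡⟨ +-assoc (+ n) ⟦ a ⟧ (- ⟦ b ⟧) ⟩
    + n + (⟦ a ⟧ - ⟦ b ⟧)      ∎)
    where b≤n+a = ℕ.≤-trans (ℕ.<⇒≤ (toℕ<n b)) (ℕ.m≤m+n n (toℕ a))

  subMod-≡-mod : ∀ n (a b : Fin n) → + n ∣ + subMod n a b - (⟦ a ⟧ - ⟦ b ⟧)
  subMod-≡-mod n a b with subMod-cases n a b
  ... | inj₁ eq rewrite eq = divides (+ 0) (+-inverseʳ (⟦ a ⟧ - ⟦ b ⟧))
  ... | inj₂ eq rewrite eq = subst (+ n ∣_) (sym (n+y-y≡n (+ n) (⟦ a ⟧ - ⟦ b ⟧))) ∣-refl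
    where
    n+y-y≡n : ∀ n y → n + y - y ≡ n
    n+y-y≡n = solve-∀

  addMod : (n : ℕ.ℕ) .{{_ : ℕ.NonZero n}} → Fin n → ℤ → Fin n
  addMod n v x = fromℕ< (n%ℕd<d (⟦ v ⟧ + x) n)

  addMod-≡-mod : ∀ n .{{_ : ℕ.NonZero n}} (v : Fin n) (x : ℤ) → + n ∣ ⟦ addMod n v x ⟧ - (⟦ v ⟧ + x)
  addMod-≡-mod n v x = divides (- (y /ℕ n)) (begin
    ⟦ addMod n v x ⟧ - y                         ≡⟨ cong (λ s → + s - y) (toℕ-fromℕ< (n%ℕd<d y n)) ⟩
    + (y %ℕ n) - y                               ≡⟨ cong (λ t → + (y %ℕ n) - t) (a≡a%ℕn+[a/ℕn]*n y n) ⟩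
    + (y %ℕ n) - (+ (y %ℕ n) + (y /ℕ n) * + n)  ≡⟨ r-[r+qn]≡-q*n (+ (y %ℕ n)) (y /ℕ n) (+ n) ⟩
    - (y /ℕ n) * + n                             ∎)
    where
    y = ⟦ v ⟧ + x
    r-[r+qn]≡-q*n : ∀ r q n → r - (r + q * n) ≡ - q * n
    r-[r+qn]≡-q*n = solve-∀

  addMod-avoids : ∀ {k n} .{{_ : ℕ.NonZero n}} → k ∣ + n → (v v' : Fin n) (x : ℤ) →
    ¬ k ∣ x → ¬ k ∣ (⟦ v ⟧ - ⟦ v' ⟧) - x →
    ¬ k ∣ + subMod n v (addMod n v' x) × ¬ k ∣ + subMod n (addMod n v' x) v'
  addMod-avoids {k} {n} k∣n v v' x k∤x k∤d-x = k∤s₁ , k∤s₂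
    where
    w = addMod n v' x
    s₁ = + subMod n v w
    s₂ = + subMod n w v'
    k∣w-[v'+x] = ∣-trans k∣n (addMod-≡-mod n v' x)
    k∣s₁-[v-w] = ∣-trans k∣n (subMod-≡-mod n v w)
    k∣s₂-[w-v'] = ∣-trans k∣n (subMod-≡-mod n w v')
    s₁-identity : ∀ s v w v' x → s - (s - (v - w)) + (w - (v' + x)) ≡ v - v' - x
    s₁-identity = solve-∀
    s₂-identity : ∀ s w v' x → s - (s - (w - v')) - (w - (v' + x)) ≡ x
    s₂-identity = solve-∀
    k∤s₁ : ¬ k ∣ s₁
    k∤s₁ k∣s₁ = k∤d-x (subst (k ∣_) (s₁-identity s₁ ⟦ v ⟧ ⟦ w ⟧ ⟦ v' ⟧ x)
      (∣m∣n⇒∣m+n (∣m∣n⇒∣m-n k∣s₁ k∣s₁-[v-w]) k∣w-[v'+x]))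
    k∤s₂ : ¬ k ∣ s₂
    k∤s₂ k∣s₂ = k∤x (subst (k ∣_) (s₂-identity s₂ ⟦ w ⟧ ⟦ v' ⟧ x)
      (∣m∣n⇒∣m-n (∣m∣n⇒∣m-n k∣s₂ k∣s₂-[w-v']) k∣w-[v'+x]))

  _∣?_ : ∀ ℓ d → Dec (+ ℓ ∣ d)
  ℓ ∣? d = map′ ∣ᵤ⇒∣ ∣⇒∣ᵤ (ℓ ℕ.∣? ℤ.∣ d ∣)

  odd-prime∣2*⇒∣ : ∀ {ℓ} → Prime ℓ → ℓ ≢ 2 → ∀ d → + ℓ ∣ + 2 * d → + ℓ ∣ d
  odd-prime∣2*⇒∣ {ℓ} pℓ ℓ≢2 d ℓ∣2d with euclidsLemma 2 ℤ.∣ d ∣ pℓ (subst (ℓ ℕ.∣_) (abs-* (+ 2) d) (∣⇒∣ᵤ ℓ∣2d))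
  ... | inj₂ ℓ∣d = ∣ᵤ⇒∣ ℓ∣d
  ... | inj₁ ℓ∣2 with prime⇒irreducible prime[2] ℓ∣2
  ...   | inj₁ ℓ≡1 = contradiction ℓ≡1 (prime≢1 pℓ)
  ...   | inj₂ ℓ≡2 = contradiction ℓ≡2 ℓ≢2

  odd-prime-avoids : ∀ {ℓ} → Prime ℓ → ℓ ≢ 2 → ∀ d P →
    (+ ℓ ∣ d → ¬ + ℓ ∣ P) → (¬ + ℓ ∣ d → + ℓ ∣ P) →
    ¬ + ℓ ∣ + 2 * d + P × ¬ + ℓ ∣ d - (+ 2 * d + P)
  odd-prime-avoids {ℓ} pℓ ℓ≢2 d P ∣d⇒∤P ∤d⇒∣P = ∤2d+P , ∤d+P ∘ ∣-negate
    where
    ∤2d+P : ¬ + ℓ ∣ + 2 * d + P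
    ∤2d+P ℓ∣x with ℓ ∣? d
    ... | yes ℓ∣d = ∣d⇒∤P ℓ∣d (∣m+n∣m⇒∣n ℓ∣x (∣n⇒∣m*n (+ 2) ℓ∣d))
    ... | no  ℓ∤d = ℓ∤d (odd-prime∣2*⇒∣ pℓ ℓ≢2 d (∣m+n∣n⇒∣m ℓ∣x (∤d⇒∣P ℓ∤d)))
    ∤d+P : ¬ + ℓ ∣ d + P
    ∤d+P ℓ∣d+P with ℓ ∣? d
    ... | yes ℓ∣d = ∣d⇒∤P ℓ∣d (∣m+n∣m⇒∣n ℓ∣d+P ℓ∣d)
    ... | no  ℓ∤d = ℓ∤d (∣m+n∣n⇒∣m ℓ∣d+P (∤d⇒∣P ℓ∤d))
    d-[2d+P]≡-[d+P] : ∀ d P → d - (+ 2 * d + P) ≡ - (d + P)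
    d-[2d+P]≡-[d+P] = solve-∀
    ∣-negate : + ℓ ∣ d - (+ 2 * d + P) → + ℓ ∣ d + P
    ∣-negate ℓ∣d-x = subst (+ ℓ ∣_) (neg-involutive (d + P))
      (∣m⇒∣-m (subst (+ ℓ ∣_) (d-[2d+P]≡-[d+P] d P) ℓ∣d-x))

  pick : ℕ.ℕ → ℤ → ℕ.ℕ
  pick ℓ d with ℓ ∣? d
  ... | yes _ = 1
  ... | no  _ = ℓ

  ∤⇒∣pick : ∀ {ℓ d} → ¬ + ℓ ∣ d → ℓ ℕ.∣ pick ℓ d
  ∤⇒∣pick {ℓ} {d} ℓ∤d with ℓ ∣? d
  ... | yes ℓ∣d = contradiction ℓ∣d ℓ∤d
  ... | no  _   = ℕ.∣-refl

  ∣pick⇒∤ : ∀ {ℓ ℓ' d} → Prime ℓ → Prime ℓ' → ℓ ℕ.∣ pick ℓ' d → ¬ + ℓ ∣ d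
  ∣pick⇒∤ {ℓ} {ℓ'} {d} pℓ pℓ' ℓ∣pick with ℓ' ∣? d
  ... | yes _    = contradiction (ℕ.∣1⇒≡1 ℓ∣pick) (prime≢1 pℓ)
  ... | no  ℓ'∤d with prime⇒irreducible pℓ' ℓ∣pick
  ...   | inj₁ ℓ≡1  = contradiction ℓ≡1 (prime≢1 pℓ)
  ...   | inj₂ refl = ℓ'∤d

  picks : List ℕ.ℕ → ℤ → ℕ.ℕ
  picks ℓs d = product (map (λ ℓ → pick ℓ d) ℓs)

  ∈⇒∣picks : ∀ {ℓ ℓs d} → ℓ ∈ ℓs → ¬ + ℓ ∣ d → ℓ ℕ.∣ picks ℓs d
  ∈⇒∣picks {ℓs = _ ∷ ℓs} {d} (here refl) ℓ∤d = ℕ.∣m⇒∣m*n (picks ℓs d) (∤⇒∣pick ℓ∤d)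
  ∈⇒∣picks {ℓs = ℓ' ∷ _} {d} (there ℓ∈ℓs) ℓ∤d = ℕ.∣n⇒∣m*n (pick ℓ' d) (∈⇒∣picks ℓ∈ℓs ℓ∤d)

  ∣picks⇒∤ : ∀ {ℓ ℓs d} → Prime ℓ → All Prime ℓs → ℓ ℕ.∣ picks ℓs d → ¬ + ℓ ∣ d
  ∣picks⇒∤ pℓ [] ℓ∣1 = contradiction (ℕ.∣1⇒≡1 ℓ∣1) (prime≢1 pℓ)
  ∣picks⇒∤ {ℓs = ℓ' ∷ ℓs} {d} pℓ (pℓ' ∷ pℓs) ℓ∣picks
    with euclidsLemma (pick ℓ' d) (picks ℓs d) pℓ ℓ∣picks
  ... | inj₁ ℓ∣pick  = ∣pick⇒∤ pℓ pℓ' ℓ∣pick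
  ... | inj₂ ℓ∣picks = ∣picks⇒∤ pℓ pℓs ℓ∣picks

  detour : (n : ℕ.ℕ) .{{_ : ℕ.NonZero n}} → Fin n → Fin n → Fin n
  detour n v v' = addMod n v' (+ 2 * d + + picks (factors (factorise n)) d)
    where d = ⟦ v ⟧ - ⟦ v' ⟧

  detour-avoids : ∀ {n ℓ} .{{_ : ℕ.NonZero n}} → Prime ℓ → ℓ ≢ 2 → ℓ ℕ.∣ n → (v v' : Fin n) →
    ℓ ℕ.∤ subMod n v (detour n v v') × ℓ ℕ.∤ subMod n (detour n v v') v'
  detour-avoids {n} {ℓ} pℓ ℓ≢2 ℓ∣n v v' =
    Product.map (_∘ ∣ᵤ⇒∣) (_∘ ∣ᵤ⇒∣) (addMod-avoids (∣ᵤ⇒∣ ℓ∣n) v v' x (proj₁ avoids) (proj₂ avoids))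
    where
    fs = factorise n
    d = ⟦ v ⟧ - ⟦ v' ⟧
    P = picks (factors fs) d
    x = + 2 * d + + P
    ℓ∈fs : ℓ ∈ factors fs
    ℓ∈fs = factorisationHasAllPrimeFactors pℓ (subst (ℓ ℕ.∣_) (isFactorisation fs) ℓ∣n) (factorsPrime fs)
    avoids : ¬ + ℓ ∣ x × ¬ + ℓ ∣ d - x
    avoids = odd-prime-avoids pℓ ℓ≢2 d (+ P)
      (λ ℓ∣d ℓ∣P → ∣picks⇒∤ pℓ (factorsPrime fs) (∣⇒∣ᵤ ℓ∣P) ℓ∣d)
      (λ ℓ∤d → ∣ᵤ⇒∣ (∈⇒∣picks ℓ∈fs ℓ∤d))

open Detour using (detour; detour-avoids)

open import Data.Nat using (ℕ; _≤_; _^_; _*_; _<_; zero; suc; z≤n; s≤s; NonZero; ≢-nonZero; ≢-nonZero⁻¹)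
open import Data.Nat.Properties using (≤-refl; ≤-trans; <-≤-trans)
open import Data.Nat.Divisibility using (_∣_; _∤_; _∣0; ∣-trans; ∣m⇒∣m*n; m∣m*n; 0∣⇒≡0; ∣1⇒≡1; ∣⇒≤)
open import Data.Nat.Coprimality using (Coprime; ¬0-coprimeTo-2+)

prime-free⇒coprime : ∀ {n y} .{{_ : NonZero n}} → (∀ {ℓ} → Prime ℓ → ℓ ∣ n → ℓ ∤ y) → Coprime y n
prime-free⇒coprime {n} _ {zero} (_ , 0∣n) = contradiction (0∣⇒≡0 0∣n) (≢-nonZero⁻¹ n)
prime-free⇒coprime free {d@(suc _)} (d∣y , d∣n) with factorise d
... | record { factors = [] ; isFactorisation = d≡1 } = d≡1
... | record { factors = ℓ ∷ ℓs ; isFactorisation = d≡ℓ*ℓs ; factorsPrime = pℓ ∷ _ } =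
  contradiction (∣-trans ℓ∣d d∣y) (free pℓ (∣-trans ℓ∣d d∣n))
  where
  ℓ∣d : ℓ ∣ d
  ℓ∣d = subst (ℓ ∣_) (sym d≡ℓ*ℓs) (m∣m*n (product ℓs))

odd⇒nonZero : ∀ {n} → 2 ∤ n → NonZero n
odd⇒nonZero 2∤n = ≢-nonZero λ { refl → 2∤n (2 ∣0) }

common-neighbour : ∀ n → 2 ∤ n → (v v' : Fin n) →
  ∃[ w ] (InPhi n (subMod n v w) × InPhi n (subMod n w v'))
common-neighbour n 2∤n v v' = detour n v v' , prime-free⇒coprime ℓ∤s₁ , prime-free⇒coprime ℓ∤s₂
  where
  instance
    _ : NonZero n
    _ = odd⇒nonZero 2∤n
  ∣n⇒≢2 : ∀ {ℓ} → ℓ ∣ n → ℓ ≢ 2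
  ∣n⇒≢2 ℓ∣n refl = 2∤n ℓ∣n
  ℓ∤s₁ : ∀ {ℓ} → Prime ℓ → ℓ ∣ n → ℓ ∤ subMod n v (detour n v v')
  ℓ∤s₁ pℓ ℓ∣n = proj₁ (detour-avoids pℓ (∣n⇒≢2 ℓ∣n) ℓ∣n v v')
  ℓ∤s₂ : ∀ {ℓ} → Prime ℓ → ℓ ∣ n → ℓ ∤ subMod n (detour n v v') v'
  ℓ∤s₂ pℓ ℓ∣n = proj₂ (detour-avoids pℓ (∣n⇒≢2 ℓ∣n) ℓ∣n v v')

Cay-distance≤2 : ∀ {n m} → 2 ∤ n → 2 ∤ m → (x y : CayV n m) → DistLe (CayAdj n m) x y 2
Cay-distance≤2 {n} {m} 2∤n 2∤m (u , v) (u' , v') =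
  let a , u~a , a~u' = common-neighbour n 2∤n u u'
      b , v~b , b~v' = common-neighbour m 2∤m v v'
  in 2 , ≤-refl , step (u~a , v~b) (step (a~u' , b~v') here)

Cay-distance≥2 : ∀ {n m} → 1 < n → 1 < m → ∃[ x ] ∃[ y ] (∀ k → k < 2 → ¬ Walk (CayAdj n m) k x y)
Cay-distance≥2 {n} {m} (s≤s (s≤s z≤n)) (s≤s (s≤s z≤n)) = (zero , zero) , (zero , suc zero) , no-short-walk
  where
  no-short-walk : ∀ k → k < 2 → ¬ Walk (CayAdj n m) k (zero , zero) (zero , suc zero)
  no-short-walk 0 _ ()
  no-short-walk 1 _ (step (0∈φ , _) here) = ¬0-coprimeTo-2+ 0∈φ
  no-short-walk (suc (suc _)) (s≤s (s≤s ()))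

Cay-diameter≡2 : ∀ {n m} → 2 ∤ n → 2 ∤ m → 1 < n → 1 < m → HasDiameter (CayAdj n m) 2
Cay-diameter≡2 2∤n 2∤m 1<n 1<m = Cay-distance≤2 2∤n 2∤m , Cay-distance≥2 1<n 1<m

prime≥3⇒odd : ∀ {p} → Prime p → 3 ≤ p → 2 ∤ p
prime≥3⇒odd pp 3≤p 2∣p with prime⇒irreducible pp 2∣p
... | inj₂ refl = contradiction 3≤p λ { (s≤s (s≤s ())) }

∤-* : ∀ {ℓ a b} → Prime ℓ → ℓ ∤ a → ℓ ∤ b → ℓ ∤ a * b
∤-* {a = a} {b} pℓ ℓ∤a ℓ∤b ℓ∣ab with euclidsLemma a b pℓ ℓ∣ab
... | inj₁ ℓ∣a = ℓ∤a ℓ∣a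
... | inj₂ ℓ∣b = ℓ∤b ℓ∣b

∤-^ : ∀ {ℓ a} → Prime ℓ → ℓ ∤ a → ∀ k → ℓ ∤ a ^ k
∤-^ pℓ ℓ∤a zero    ℓ∣1 = prime≢1 pℓ (∣1⇒≡1 ℓ∣1)
∤-^ pℓ ℓ∤a (suc k) = ∤-* pℓ ℓ∤a (∤-^ pℓ ℓ∤a k)

proposition4p5 : (p q r α β γ : ℕ) → Prime p → Prime q → Prime r →
    3 ≤ p → 3 ≤ q → 3 ≤ r → p ≢ q → p ≢ r → q ≢ r →
    1 ≤ α → 1 ≤ β → 1 ≤ γ →
    HasDiameter (CayAdj p (p ^ α * q ^ β * r ^ γ)) 2
proposition4p5 p q r (suc α) β γ pp pq pr 3≤p 3≤q 3≤r _ _ _ (s≤s z≤n) _ _ =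
  Cay-diameter≡2 2∤p 2∤m 1<p (<-≤-trans 1<p (∣⇒≤ {{odd⇒nonZero 2∤m}} p∣m))
  where
  m = p ^ suc α * q ^ β * r ^ γ
  2∤p = prime≥3⇒odd pp 3≤p
  2∤m : 2 ∤ m
  2∤m = ∤-* prime[2] (∤-* prime[2] (∤-^ prime[2] 2∤p (suc α)) (∤-^ prime[2] (prime≥3⇒odd pq 3≤q) β))
                     (∤-^ prime[2] (prime≥3⇒odd pr 3≤r) γ)
  1<p : 1 < p
  1<p = ≤-trans (s≤s (s≤s z≤n)) 3≤p
  p∣m : p ∣ m
  p∣m = ∣m⇒∣m*n (r ^ γ) (∣m⇒∣m*n (q ^ β) (m∣m*n (p ^ α)))
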